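{- Let $\mathbf A=\langle A,\land,\lor,*,\Rightarrow,1\rangle$ be either an implicative lattice or (the reduct $\langle A,\land,\lor,*,\Rightarrow,1\rangle$, with $x*y:=\neg(x\Rightarrow\neg y)$, of) an $\mathcal S$-algebra. Then the doubling $\mathbf A^*$ (as $\langle A^*,\land,\lor,\Rightarrow,\neg,\neg1,1\rangle$) is an $\mathcal S$-algebra.
   Context: A commutative integral residuated lattice (CIRL) is an algebra $\langle A,\land,\lor,*,\Rightarrow,1\rangle$ such that $\langle A,\land,\lor\rangle$ is a lattice with top element $1$, $\langle A,*,1\rangle$ is a commutative monoid, and $a*b\le c$ iff $b\le a\Rightarrow c$. An implicative lattice is a CIRL in which $*$ coincides with $\land$. Doubling: given a CIRL $\mathbf A$, let $\neg A=\{\neg a:a\in A\}$ be a disjoint copy of $A$ and $A^*=A\cup\neg A$. Order $A^*$ by: for $a,b\in A$, $a\le b$ iff $a\le_A b$; $\neg a\le b$ always; $\neg a\le\neg b$ iff $b\le_A a$ (and $a\not\le\neg b$). Set $\neg(\neg a):=a$; on $A$ the operations are those of $\mathbf A$; $\neg a\land\neg b:=\neg(a\lor b)$, $\neg a\lor\neg b:=\neg(a\land b)$ (mixed meets/joins are determined by the order); $a*\neg b=\neg b*a:=\neg(a\Rightarrow b)$, $\neg a*\neg b:=\neg1$; $a\Rightarrow\neg b:=\neg(a*b)$, $\neg a\Rightarrow\neg b:=b\Rightarrow a$, $\neg a\Rightarrow b:=1$; the constants are $1$ and $0:=\neg 1$. Nelson's logic $\mathcal S$ is the sentential logic in the language $\langle\land,\lor,\Rightarrow,\neg,0\rangle$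 given by the following Hilbert-style calculus. Abbreviations: $\phi\Leftrightarrow\psi:=(\phi\Rightarrow\psi)\land(\psi\Rightarrow\phi)$, $1:=\neg 0$, $\phi\Rightarrow^2\psi:=\phi\Rightarrow(\phi\Rightarrow\psi)$; for a finite (possibly empty) list $\Gamma=(\phi_1,\dots,\phi_n)$, $\Gamma\Rightarrow\phi:=\phi_1\Rightarrow(\phi_2\Rightarrow(\cdots(\phi_n\Rightarrow\phi)\cdots))$ and $\Gamma\Rightarrow^2\phi:=\phi_1\Rightarrow^2(\cdots(\phi_n\Rightarrow^2\phi)\cdots)$, both $\phi$ if $\Gamma$ is empty. Axioms: (A1) $\phi\Rightarrow\phi$; (A2) $0\Rightarrow\psi$; (A3) $\neg\phi\Rightarrow(\phi\Rightarrow0)$; (A4) $1$; (A5) $(\phi\Rightarrow\psi)\Leftrightarrow(\neg\psi\Rightarrow\neg\phi)$. Rules ("premisses / conclusion", for every finite list $\Gamma$): (P) $\Gamma\Rightarrow(\phi\Rightarrow(\psi\Rightarrow\gamma))$ / $\Gamma\Rightarrow(\psi\Rightarrow(\phi\Rightarrow\gamma))$; (C) $\phi\Rightarrow(\phi\Rightarrow(\phi\Rightarrow\gamma))$ / $\phi\Rightarrow(\phi\Rightarrow\gamma)$; (E) $\Gamma\Rightarrow\phi$, $\phi\Rightarrow\gamma$ / $\Gamma\Rightarrow\gamma$; ($\Rightarrow$l) $\Gamma\Rightarrow\phi$, $\psi\Rightarrow\gamma$ / $\Gamma\Rightarrow((\phi\Rightarrow\psi)\Rightarrow\gamma)$; ($\Rightarrow$r)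 $\gamma$ / $\phi\Rightarrow\gamma$; ($\land$l1) $\phi\Rightarrow\gamma$ / $(\phi\land\psi)\Rightarrow\gamma$; ($\land$l2) $\psi\Rightarrow\gamma$ / $(\phi\land\psi)\Rightarrow\gamma$; ($\land$r) $\Gamma\Rightarrow\phi$, $\Gamma\Rightarrow\psi$ / $\Gamma\Rightarrow(\phi\land\psi)$; ($\lor$l1) $\phi\Rightarrow\gamma$, $\psi\Rightarrow\gamma$ / $(\phi\lor\psi)\Rightarrow\gamma$; ($\lor$l2) $\phi\Rightarrow^2\gamma$, $\psi\Rightarrow^2\gamma$ / $(\phi\lor\psi)\Rightarrow^2\gamma$; ($\lor$r1) $\Gamma\Rightarrow\phi$ / $\Gamma\Rightarrow(\phi\lor\psi)$; ($\lor$r2) $\Gamma\Rightarrow\psi$ / $\Gamma\Rightarrow(\phi\lor\psi)$; ($\neg\Rightarrow$l) $(\phi\land\neg\psi)\Rightarrow\gamma$ / $\neg(\phi\Rightarrow\psi)\Rightarrow\gamma$; ($\neg\Rightarrow$r) $\Gamma\Rightarrow^2(\phi\land\neg\psi)$ / $\Gamma\Rightarrow^2\neg(\phi\Rightarrow\psi)$; ($\neg\land$l) $(\neg\phi\lor\neg\psi)\Rightarrow\gamma$ / $\neg(\phi\land\psi)\Rightarrow\gamma$; ($\neg\land$r) $\Gamma\Rightarrow(\neg\phi\lor\neg\psi)$ / $\Gamma\Rightarrow\neg(\phi\land\psi)$; ($\neg\lor$l) $(\neg\phi\land\neg\psi)\Rightarrow\gamma$ / $\neg(\phi\lor\psi)\Rightarrow\gamma$;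 ($\neg\lor$r) $\Gamma\Rightarrow(\neg\phi\land\neg\psi)$ / $\Gamma\Rightarrow\neg(\phi\lor\psi)$; ($\neg\neg$l) $\phi\Rightarrow\gamma$ / $\neg\neg\phi\Rightarrow\gamma$; ($\neg\neg$r) $\Gamma\Rightarrow\phi$ / $\Gamma\Rightarrow\neg\neg\phi$. An $\mathcal S$-algebra is an algebra $\langle A,\land,\lor,\Rightarrow,\neg,0,1\rangle$ of type $\langle2,2,2,1,0,0\rangle$ satisfying: (i) $\varphi\approx1$ for every axiom (A1)–(A5), formulas read as terms and the abbreviation $1:=\neg0$ written out (so (A4) gives $\neg0\approx1$); (ii) $x\Rightarrow x\approx1$; (iii) for each rule with premisses $\varphi_1,\dots,\varphi_n$ and conclusion $\varphi$, the quasi-equation $(\varphi_1\approx1\ \&\cdots\&\ \varphi_n\approx1)\Longrightarrow\varphi\approx1$; (iv) $(x\Rightarrow y\approx1\ \&\ y\Rightarrow x\approx1)\Longrightarrow x\approx y$. -}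

module Defs where

open import Level using (Level; suc)
open import Data.Sum using (_⊎_; inj₁; inj₂)
open import Data.Product using (_×_)
open import Data.List using (List; []; _∷_)
open import Relation.Binary.PropositionalEquality using (_≡_)

-- Raw signature <A, ∧, ∨, *, ⇒, 1> of a commutative integral residuated lattice.
record CIRLSig (ℓ : Level) : Set (suc ℓ) where
  infixr 5 _⇒_
  infixl 7 _∧_
  infixl 6 _∨_
  infixl 7 _*_
  infix 4 _≤_
  field
    Carrier : Set ℓ
    _∧_ _∨_ _*_ _⇒_ : Carrier → Carrier → Carrier
    𝟙 : Carrier

  _≤_ : Carrier → Carrier → Set ℓ
  x ≤ y = x ∧ y ≡ x

record IsCIRL {ℓ : Level} (A : CIRLSig ℓ) : Set ℓ where
  open CIRLSig A
  field
    ∧-comm  : ∀ x y → x ∧ y ≡ y ∧ x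
    ∧-assoc : ∀ x y z → (x ∧ y) ∧ z ≡ x ∧ (y ∧ z)
    ∨-comm  : ∀ x y → x ∨ y ≡ y ∨ x
    ∨-assoc : ∀ x y z → (x ∨ y) ∨ z ≡ x ∨ (y ∨ z)
    ∧-absorbs-∨ : ∀ x y → x ∧ (x ∨ y) ≡ x
    ∨-absorbs-∧ : ∀ x y → x ∨ (x ∧ y) ≡ x
    top     : ∀ x → x ≤ 𝟙
    *-comm  : ∀ x y → x * y ≡ y * x
    *-assoc : ∀ x y z → (x * y) * z ≡ x * (y * z)
    *-identity : ∀ x → x * 𝟙 ≡ x
    residuation₁ : ∀ a b c → a * b ≤ c → b ≤ (a ⇒ c)
    residuation₂ : ∀ a b c → b ≤ (a ⇒ c) → a * b ≤ c

record ImplicativeLattice (ℓ : Level) : Set (suc ℓ) where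
  field
    sig    : CIRLSig ℓ
    isCIRL : IsCIRL sig
  open CIRLSig sig
  field
    *-is-∧ : ∀ x y → x * y ≡ x ∧ y

record SSig (ℓ : Level) : Set (suc ℓ) where
  infixr 5 _⇒_
  infixl 7 _∧_
  infixl 6 _∨_
  infix 8 ¬_
  field
    Carrier : Set ℓ
    _∧_ _∨_ _⇒_ : Carrier → Carrier → Carrier
    ¬_ : Carrier → Carrier
    𝟘 𝟙 : Carrier

  _⇔_ : Carrier → Carrier → Carrier
  x ⇔ y = (x ⇒ y) ∧ (y ⇒ x)

  _⇒²_ : Carrier → Carrier → Carrier
  x ⇒² y = x ⇒ (x ⇒ y)

  imps : List Carrier → Carrier → Carrier
  imps [] φ = φ
  imps (x ∷ Γ) φ = x ⇒ imps Γ φ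

  imps² : List Carrier → Carrier → Carrier
  imps² [] φ = φ
  imps² (x ∷ Γ) φ = x ⇒² imps² Γ φ

record IsSAlgebra {ℓ : Level} (S : SSig ℓ) : Set ℓ where
  open SSig S
  field
    A1 : ∀ φ → φ ⇒ φ ≡ 𝟙
    A2 : ∀ ψ → 𝟘 ⇒ ψ ≡ 𝟙
    A3 : ∀ φ → ¬ φ ⇒ (φ ⇒ 𝟘) ≡ 𝟙
    A4 : ¬ 𝟘 ≡ 𝟙
    A5 : ∀ φ ψ → (φ ⇒ ψ) ⇔ (¬ ψ ⇒ ¬ φ) ≡ 𝟙
    refl⇒ : ∀ x → x ⇒ x ≡ 𝟙
    rP : ∀ Γ φ ψ γ → imps Γ (φ ⇒ (ψ ⇒ γ)) ≡ 𝟙 → imps Γ (ψ ⇒ (φ ⇒ γ)) ≡ 𝟙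
    rC : ∀ φ γ → φ ⇒ (φ ⇒ (φ ⇒ γ)) ≡ 𝟙 → φ ⇒ (φ ⇒ γ) ≡ 𝟙
    rE : ∀ Γ φ γ → imps Γ φ ≡ 𝟙 → φ ⇒ γ ≡ 𝟙 → imps Γ γ ≡ 𝟙
    r⇒l : ∀ Γ φ ψ γ → imps Γ φ ≡ 𝟙 → ψ ⇒ γ ≡ 𝟙 → imps Γ ((φ ⇒ ψ) ⇒ γ) ≡ 𝟙
    r⇒r : ∀ φ γ → γ ≡ 𝟙 → φ ⇒ γ ≡ 𝟙
    r∧l1 : ∀ φ ψ γ → φ ⇒ γ ≡ 𝟙 → (φ ∧ ψ) ⇒ γ ≡ 𝟙
    r∧l2 : ∀ φ ψ γ → ψ ⇒ γ ≡ 𝟙 → (φ ∧ ψ) ⇒ γ ≡ 𝟙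
    r∧r : ∀ Γ φ ψ → imps Γ φ ≡ 𝟙 → imps Γ ψ ≡ 𝟙 → imps Γ (φ ∧ ψ) ≡ 𝟙
    r∨l1 : ∀ φ ψ γ → φ ⇒ γ ≡ 𝟙 → ψ ⇒ γ ≡ 𝟙 → (φ ∨ ψ) ⇒ γ ≡ 𝟙
    r∨l2 : ∀ φ ψ γ → φ ⇒² γ ≡ 𝟙 → ψ ⇒² γ ≡ 𝟙 → (φ ∨ ψ) ⇒² γ ≡ 𝟙
    r∨r1 : ∀ Γ φ ψ → imps Γ φ ≡ 𝟙 → imps Γ (φ ∨ ψ) ≡ 𝟙
    r∨r2 : ∀ Γ φ ψ → imps Γ ψ ≡ 𝟙 → imps Γ (φ ∨ ψ) ≡ 𝟙
    r¬⇒l : ∀ φ ψ γ → (φ ∧ ¬ ψ) ⇒ γ ≡ 𝟙 → ¬ (φ ⇒ ψ) ⇒ γ ≡ 𝟙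
    r¬⇒r : ∀ Γ φ ψ → imps² Γ (φ ∧ ¬ ψ) ≡ 𝟙 → imps² Γ (¬ (φ ⇒ ψ)) ≡ 𝟙
    r¬∧l : ∀ φ ψ γ → (¬ φ ∨ ¬ ψ) ⇒ γ ≡ 𝟙 → ¬ (φ ∧ ψ) ⇒ γ ≡ 𝟙
    r¬∧r : ∀ Γ φ ψ → imps Γ (¬ φ ∨ ¬ ψ) ≡ 𝟙 → imps Γ (¬ (φ ∧ ψ)) ≡ 𝟙
    r¬∨l : ∀ φ ψ γ → (¬ φ ∧ ¬ ψ) ⇒ γ ≡ 𝟙 → ¬ (φ ∨ ψ) ⇒ γ ≡ 𝟙
    r¬∨r : ∀ Γ φ ψ → imps Γ (¬ φ ∧ ¬ ψ) ≡ 𝟙 → imps Γ (¬ (φ ∨ ψ)) ≡ 𝟙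
    r¬¬l : ∀ φ γ → φ ⇒ γ ≡ 𝟙 → ¬ ¬ φ ⇒ γ ≡ 𝟙
    r¬¬r : ∀ Γ φ → imps Γ φ ≡ 𝟙 → imps Γ (¬ ¬ φ) ≡ 𝟙
    antisym : ∀ x y → x ⇒ y ≡ 𝟙 → y ⇒ x ≡ 𝟙 → x ≡ y

record SAlgebra (ℓ : Level) : Set (suc ℓ) where
  field
    sig : SSig ℓ
    isSAlgebra : IsSAlgebra sig

reduct : {ℓ : Level} → SAlgebra ℓ → CIRLSig ℓ
reduct S = record
  { Carrier = Carrier
  ; _∧_ = _∧_
  ; _∨_ = _∨_
  ; _*_ = λ x y → ¬ (x ⇒ ¬ y)
  ; _⇒_ = _⇒_
  ; 𝟙 = 𝟙
  }
  where open SSig (SAlgebra.sig S)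

-- The doubling A* = A ∪ ¬A, with A represented by inj₁ and ¬A by inj₂.
module Doubling {ℓ : Level} (A : CIRLSig ℓ) where
  open CIRLSig A

  D : Set ℓ
  D = Carrier ⊎ Carrier

  -- meets/joins; mixed cases determined by ¬a ≤ b
  _∧*_ : D → D → D
  inj₁ a ∧* inj₁ b = inj₁ (a ∧ b)
  inj₁ a ∧* inj₂ b = inj₂ b
  inj₂ a ∧* inj₁ b = inj₂ a
  inj₂ a ∧* inj₂ b = inj₂ (a ∨ b)

  _∨*_ : D → D → D
  inj₁ a ∨* inj₁ b = inj₁ (a ∨ b)
  inj₁ a ∨* inj₂ b = inj₁ a
  inj₂ a ∨* inj₁ b = inj₁ b
  inj₂ a ∨* inj₂ b = inj₂ (a ∧ b)

  _⇒*_ : D → D → D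
  inj₁ a ⇒* inj₁ b = inj₁ (a ⇒ b)
  inj₁ a ⇒* inj₂ b = inj₂ (a * b)
  inj₂ a ⇒* inj₁ b = inj₁ 𝟙
  inj₂ a ⇒* inj₂ b = inj₁ (b ⇒ a)

  ¬*_ : D → D
  ¬* inj₁ a = inj₂ a
  ¬* inj₂ a = inj₁ a

  double : SSig ℓ
  double = record
    { Carrier = D
    ; _∧_ = _∧*_
    ; _∨_ = _∨*_
    ; _⇒_ = _⇒*_
    ; ¬_ = ¬*_
    ; 𝟘 = inj₂ 𝟙
    ; 𝟙 = inj₁ 𝟙
    }

open Doubling public using (double)

module Submission where

-- Both kinds of algebra share a common core: a commutative integral residuated
-- lattice, presented through the order  x ⊑ y :⇔ x ⇒ y = 1,  which is
-- 3-potent (x² ≤ x³) and in which squares respect joins (x² ≤ z and y² ≤ z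
-- give (x ∨ y)² ≤ z).  We call such structures *potent CIRLs*.
--
--   1. develop the residuated-lattice arithmetic of a potent CIRL, including
--      the reading of a context Γ ⇒ φ = 1 as  ∏Γ ⊑ φ;
--   2. show that the doubling A* of a potent CIRL A, equipped with the product
--      a * ¬b := ¬(a ⇒ b), ¬a * ¬b := ¬1, is again a potent CIRL;
--   3. show that A* validates every axiom and rule of Nelson's logic, reducing
--      the context rules to order facts in the potent CIRL A* via step 1;
--   4. show that implicative lattices and reducts of S-algebras are potent CIRLs.

open import Defs
open import Level using (Level)
open import Data.Product using (_×_; _,_)
open import Data.Sum using (inj₁; inj₂)
open import Data.Sum.Properties using (inj₁-injective)
open import Data.List using (List; []; _∷_)
open import Relation.Binary.PropositionalEquality
open import Algebra.Lattice.Bundles using (Lattice)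
import Algebra.Lattice.Properties.Lattice as LatticeProperties
import Relation.Binary.Lattice as OrderLattice

record IsPotentCIRL {ℓ : Level} (A : CIRLSig ℓ) : Set ℓ where
  open CIRLSig A
  infix 4 _⊑_
  _⊑_ : Carrier → Carrier → Set ℓ
  x ⊑ y = (x ⇒ y) ≡ 𝟙
  field
    ⊑-refl     : ∀ x → x ⊑ x
    ⊑-trans    : ∀ {x y z} → x ⊑ y → y ⊑ z → x ⊑ z
    ⊑-antisym  : ∀ {x y} → x ⊑ y → y ⊑ x → x ≡ y
    ∧-lower₁   : ∀ x y → x ∧ y ⊑ x
    ∧-lower₂   : ∀ x y → x ∧ y ⊑ y
    ∧-greatest : ∀ {x y z} → z ⊑ x → z ⊑ y → z ⊑ x ∧ y
    ∨-upper₁   : ∀ x y → x ⊑ x ∨ y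
    ∨-upper₂   : ∀ x y → y ⊑ x ∨ y
    ∨-least    : ∀ {x y z} → x ⊑ z → y ⊑ z → x ∨ y ⊑ z
    top        : ∀ x → x ⊑ 𝟙
    *-comm     : ∀ x y → x * y ≡ y * x
    *-assoc    : ∀ x y z → (x * y) * z ≡ x * (y * z)
    *-identity : ∀ x → x * 𝟙 ≡ x
    res-intro  : ∀ {x y z} → x * y ⊑ z → y ⊑ x ⇒ z
    res-elim   : ∀ {x y z} → y ⊑ x ⇒ z → x * y ⊑ z
    3-potent   : ∀ x → x * x ⊑ x * (x * x)
    square-∨   : ∀ {x y z} → x * x ⊑ z → y * y ⊑ z → (x ∨ y) * (x ∨ y) ⊑ z

module PotentCIRLTheory {ℓ : Level} {A : CIRLSig ℓ} (P : IsPotentCIRL A) where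
  open CIRLSig A
  open IsPotentCIRL P

  ⊑-respˡ : ∀ {x x' y} → x ≡ x' → x ⊑ y → x' ⊑ y
  ⊑-respˡ refl h = h

  𝟙⊑⇒≡𝟙 : ∀ {y} → 𝟙 ⊑ y → y ≡ 𝟙
  𝟙⊑⇒≡𝟙 {y} h = ⊑-antisym (top y) h

  𝟙∧𝟙 : 𝟙 ∧ 𝟙 ≡ 𝟙
  𝟙∧𝟙 = 𝟙⊑⇒≡𝟙 (∧-greatest (⊑-refl 𝟙) (⊑-refl 𝟙))

  *-identityˡ : ∀ x → 𝟙 * x ≡ x
  *-identityˡ x = trans (*-comm 𝟙 x) (*-identity x)

  *-swapˡ : ∀ x y z → x * (y * z) ≡ y * (x * z)
  *-swapˡ x y z = begin
    x * (y * z)  ≡⟨ *-assoc x y z ⟨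
    (x * y) * z  ≡⟨ cong (_* z) (*-comm x y) ⟩
    (y * x) * z  ≡⟨ *-assoc y x z ⟩
    y * (x * z)  ∎
    where open ≡-Reasoning

  -- Residuation makes multiplication monotone.
  *-monoʳ : ∀ z {x y} → x ⊑ y → z * x ⊑ z * y
  *-monoʳ z {y = y} h = res-elim (⊑-trans h (res-intro (⊑-refl (z * y))))

  *-mono : ∀ {x x' y y'} → x ⊑ x' → y ⊑ y' → x * y ⊑ x' * y'
  *-mono {x} {x'} {y} {y'} hx hy = ⊑-trans
    (subst₂ _⊑_ (*-comm y x) (*-comm y x') (*-monoʳ y hx)) (*-monoʳ x' hy)

  *-decreasingˡ : ∀ x y → x * y ⊑ x
  *-decreasingˡ x y = subst (x * y ⊑_) (*-identity x) (*-monoʳ x (top y))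

  *-decreasingʳ : ∀ x y → x * y ⊑ y
  *-decreasingʳ x y = subst (_⊑ y) (*-comm y x) (*-decreasingˡ y x)

  modus-ponens : ∀ x y → x * (x ⇒ y) ⊑ y
  modus-ponens x y = res-elim (⊑-refl (x ⇒ y))

  weakening : ∀ x y → y ⊑ x ⇒ y
  weakening x y = res-intro (*-decreasingʳ x y)

  indirect-≡ : ∀ {a b} → (∀ z → z ⊑ a → z ⊑ b) → (∀ z → z ⊑ b → z ⊑ a) → a ≡ b
  indirect-≡ {a} {b} f g = ⊑-antisym (f a (⊑-refl a)) (g b (⊑-refl b))

  ⇒⇒-elim : ∀ {x y z w} → z ⊑ x ⇒ (y ⇒ w) → y * (x * z) ⊑ w
  ⇒⇒-elim h = res-elim (res-elim h)

  ⇒⇒-intro : ∀ {x y z w} → y * (x * z) ⊑ w → z ⊑ x ⇒ (y ⇒ w)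
  ⇒⇒-intro h = res-intro (res-intro h)

  ⇒-exchange : ∀ x y w → x ⇒ (y ⇒ w) ≡ y ⇒ (x ⇒ w)
  ⇒-exchange x y w = indirect-≡
    (λ z h → ⇒⇒-intro (⊑-respˡ (*-swapˡ y x z) (⇒⇒-elim h)))
    (λ z h → ⇒⇒-intro (⊑-respˡ (*-swapˡ x y z) (⇒⇒-elim h)))

  ⇒-curry : ∀ x y w → (x * y) ⇒ w ≡ x ⇒ (y ⇒ w)
  ⇒-curry x y w = indirect-≡
    (λ z h → ⇒⇒-intro (⊑-respˡ reassoc (res-elim h)))
    (λ z h → res-intro (⊑-respˡ (sym reassoc) (⇒⇒-elim h)))
    where
      reassoc : ∀ {z} → (x * y) * z ≡ y * (x * z)
      reassoc {z} = trans (cong (_* z) (*-comm x y)) (*-assoc y x z)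

  𝟙⇒-identity : ∀ x → 𝟙 ⇒ x ≡ x
  𝟙⇒-identity x = indirect-≡
    (λ z h → ⊑-respˡ (*-identityˡ z) (res-elim h))
    (λ z h → res-intro (⊑-respˡ (sym (*-identityˡ z)) h))

  ∏ : List Carrier → Carrier
  ∏ []      = 𝟙
  ∏ (x ∷ Γ) = x * ∏ Γ

  _⇒⋆_ : List Carrier → Carrier → Carrier
  []      ⇒⋆ φ = φ
  (x ∷ Γ) ⇒⋆ φ = x ⇒ (Γ ⇒⋆ φ)

  ⇒⋆-elim : ∀ Γ {φ z} → z ⊑ Γ ⇒⋆ φ → z * ∏ Γ ⊑ φ
  ⇒⋆-elim []      {z = z} h = ⊑-respˡ (sym (*-identity z)) h
  ⇒⋆-elim (x ∷ Γ) {z = z} h =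
    ⊑-respˡ (*-swapˡ x z (∏ Γ)) (⊑-respˡ (*-assoc x z (∏ Γ)) (⇒⋆-elim Γ (res-elim h)))

  ⇒⋆-intro : ∀ Γ {φ z} → z * ∏ Γ ⊑ φ → z ⊑ Γ ⇒⋆ φ
  ⇒⋆-intro []      {z = z} h = ⊑-respˡ (*-identity z) h
  ⇒⋆-intro (x ∷ Γ) {z = z} h =
    res-intro (⇒⋆-intro Γ (⊑-respˡ (sym (*-assoc x z (∏ Γ))) (⊑-respˡ (*-swapˡ z x (∏ Γ)) h)))

  ⇒⋆-sound : ∀ Γ {φ} → Γ ⇒⋆ φ ≡ 𝟙 → ∏ Γ ⊑ φ
  ⇒⋆-sound Γ h = ⊑-respˡ (*-identityˡ (∏ Γ)) (⇒⋆-elim Γ (subst (𝟙 ⊑_) (sym h) (⊑-refl 𝟙)))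

  ⇒⋆-complete : ∀ Γ {φ} → ∏ Γ ⊑ φ → Γ ⇒⋆ φ ≡ 𝟙
  ⇒⋆-complete Γ h = 𝟙⊑⇒≡𝟙 (⇒⋆-intro Γ (⊑-respˡ (sym (*-identityˡ (∏ Γ))) h))

  -- 3-potency makes every square idempotent; products of idempotents are
  -- idempotent, so the product of a list with every entry doubled is.
  cube≡square : ∀ x → x * (x * x) ≡ x * x
  cube≡square x = ⊑-antisym (*-decreasingʳ x (x * x)) (3-potent x)

  square-idempotent : ∀ x → (x * x) * (x * x) ≡ x * x
  square-idempotent x = trans (*-assoc x x (x * x)) (trans (cong (x *_) (cube≡square x)) (cube≡square x))

  *-idempotent : ∀ {p q} → p * p ≡ p → q * q ≡ q → (p * q) * (p * q) ≡ p * q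
  *-idempotent {p} {q} hp hq = begin
    (p * q) * (p * q)  ≡⟨ *-assoc p q (p * q) ⟩
    p * (q * (p * q))  ≡⟨ cong (p *_) (*-swapˡ q p q) ⟩
    p * (p * (q * q))  ≡⟨ *-assoc p p (q * q) ⟨
    (p * p) * (q * q)  ≡⟨ cong₂ _*_ hp hq ⟩
    p * q              ∎
    where open ≡-Reasoning

  doubled : List Carrier → List Carrier
  doubled []      = []
  doubled (x ∷ Γ) = x ∷ x ∷ doubled Γ

  ∏-doubled-idempotent : ∀ Γ → ∏ (doubled Γ) * ∏ (doubled Γ) ≡ ∏ (doubled Γ)
  ∏-doubled-idempotent []      = *-identity 𝟙
  ∏-doubled-idempotent (x ∷ Γ) =
    subst (λ t → t * t ≡ t) (*-assoc x x (∏ (doubled Γ)))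
      (*-idempotent (square-idempotent x) (∏-doubled-idempotent Γ))

  idempotent-∧⇒* : ∀ {p x y} → p * p ≡ p → p ⊑ x ∧ y → p ⊑ x * y
  idempotent-∧⇒* {x = x} {y} hp h =
    ⊑-respˡ hp (*-mono (⊑-trans h (∧-lower₁ x y)) (⊑-trans h (∧-lower₂ x y)))

  -- The order-theoretic content of the rules (C), (∨l2) and (⇒l).
  contraction : ∀ x w → x ⊑ x ⇒ (x ⇒ w) → x ⊑ x ⇒ w
  contraction x w h = res-intro (⊑-trans (3-potent x) (⇒⇒-elim h))

  square-∨-rule : ∀ x y w → x ⊑ x ⇒ w → y ⊑ y ⇒ w → x ∨ y ⊑ (x ∨ y) ⇒ w
  square-∨-rule x y w hx hy = res-intro (square-∨ (res-elim hx) (res-elim hy))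

  ⇒-left : ∀ {p x y w} → p ⊑ x → y ⊑ w → p ⊑ (x ⇒ y) ⇒ w
  ⇒-left {x = x} {y} hx hy = res-intro
    (⊑-trans (*-monoʳ _ hx) (⊑-trans (⊑-respˡ (*-comm x _) (modus-ponens x y)) hy))

module DoublingIsPotent {ℓ : Level} {A : CIRLSig ℓ} (P : IsPotentCIRL A) where
  open CIRLSig A
  open IsPotentCIRL P
  open PotentCIRLTheory P
  open Doubling A

  infixl 7 _⊛_
  _⊛_ : D → D → D
  inj₁ a ⊛ inj₁ b = inj₁ (a * b)
  inj₁ a ⊛ inj₂ b = inj₂ (a ⇒ b)
  inj₂ a ⊛ inj₁ b = inj₂ (b ⇒ a)
  inj₂ a ⊛ inj₂ b = inj₂ 𝟙

  doubledCIRL : CIRLSig ℓ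
  doubledCIRL = record
    { Carrier = D ; _∧_ = _∧*_ ; _∨_ = _∨*_ ; _*_ = _⊛_ ; _⇒_ = _⇒*_ ; 𝟙 = inj₁ 𝟙 }

  infix 4 _⊑*_
  _⊑*_ : D → D → Set ℓ
  x ⊑* y = (x ⇒* y) ≡ inj₁ 𝟙

  -- Comparisons within A and within ¬A are comparisons in A (reversed on ¬A).
  lift : ∀ {a b} → a ⊑ b → inj₁ a ⊑* inj₁ b
  lift = cong inj₁

  unlift : ∀ {a b} → inj₁ a ⊑* inj₁ b → a ⊑ b
  unlift = inj₁-injective

  ⊑*-refl : ∀ x → x ⊑* x
  ⊑*-refl (inj₁ a) = lift (⊑-refl a)
  ⊑*-refl (inj₂ a) = lift (⊑-refl a)

  ⊑*-trans : ∀ {x y z} → x ⊑* y → y ⊑* z → x ⊑* z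
  ⊑*-trans {inj₁ a} {inj₁ b} {inj₁ c} h₁ h₂ = lift (⊑-trans (unlift h₁) (unlift h₂))
  ⊑*-trans {inj₁ a} {inj₁ b} {inj₂ c} h₁ ()
  ⊑*-trans {inj₁ a} {inj₂ b}          ()
  ⊑*-trans {inj₂ a} {y}      {inj₁ c} h₁ h₂ = refl
  ⊑*-trans {inj₂ a} {inj₁ b} {inj₂ c} h₁ ()
  ⊑*-trans {inj₂ a} {inj₂ b} {inj₂ c} h₁ h₂ = lift (⊑-trans (unlift h₂) (unlift h₁))

  ⊑*-antisym : ∀ {x y} → x ⊑* y → y ⊑* x → x ≡ y
  ⊑*-antisym {inj₁ a} {inj₁ b} h₁ h₂ = cong inj₁ (⊑-antisym (unlift h₁) (unlift h₂))
  ⊑*-antisym {inj₁ a} {inj₂ b} ()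
  ⊑*-antisym {inj₂ a} {inj₁ b} h₁ ()
  ⊑*-antisym {inj₂ a} {inj₂ b} h₁ h₂ = cong inj₂ (⊑-antisym (unlift h₂) (unlift h₁))

  ∧*-lower₁ : ∀ x y → (x ∧* y) ⊑* x
  ∧*-lower₁ (inj₁ a) (inj₁ b) = lift (∧-lower₁ a b)
  ∧*-lower₁ (inj₁ a) (inj₂ b) = refl
  ∧*-lower₁ (inj₂ a) (inj₁ b) = lift (⊑-refl a)
  ∧*-lower₁ (inj₂ a) (inj₂ b) = lift (∨-upper₁ a b)

  ∧*-lower₂ : ∀ x y → (x ∧* y) ⊑* y
  ∧*-lower₂ (inj₁ a) (inj₁ b) = lift (∧-lower₂ a b)
  ∧*-lower₂ (inj₁ a) (inj₂ b) = lift (⊑-refl b)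
  ∧*-lower₂ (inj₂ a) (inj₁ b) = refl
  ∧*-lower₂ (inj₂ a) (inj₂ b) = lift (∨-upper₂ a b)

  ∧*-greatest : ∀ {x y z} → z ⊑* x → z ⊑* y → z ⊑* (x ∧* y)
  ∧*-greatest {inj₁ a} {inj₁ b} {inj₁ c} h₁ h₂ = lift (∧-greatest (unlift h₁) (unlift h₂))
  ∧*-greatest {inj₁ a} {inj₂ b} {inj₁ c} h₁ ()
  ∧*-greatest {inj₂ a} {y}      {inj₁ c} ()
  ∧*-greatest {inj₁ a} {inj₁ b} {inj₂ c} h₁ h₂ = refl
  ∧*-greatest {inj₁ a} {inj₂ b} {inj₂ c} h₁ h₂ = h₂
  ∧*-greatest {inj₂ a} {inj₁ b} {inj₂ c} h₁ h₂ = h₁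
  ∧*-greatest {inj₂ a} {inj₂ b} {inj₂ c} h₁ h₂ = lift (∨-least (unlift h₁) (unlift h₂))

  ∨*-upper₁ : ∀ x y → x ⊑* (x ∨* y)
  ∨*-upper₁ (inj₁ a) (inj₁ b) = lift (∨-upper₁ a b)
  ∨*-upper₁ (inj₁ a) (inj₂ b) = lift (⊑-refl a)
  ∨*-upper₁ (inj₂ a) (inj₁ b) = refl
  ∨*-upper₁ (inj₂ a) (inj₂ b) = lift (∧-lower₁ a b)

  ∨*-upper₂ : ∀ x y → y ⊑* (x ∨* y)
  ∨*-upper₂ (inj₁ a) (inj₁ b) = lift (∨-upper₂ a b)
  ∨*-upper₂ (inj₁ a) (inj₂ b) = refl
  ∨*-upper₂ (inj₂ a) (inj₁ b) = lift (⊑-refl b)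
  ∨*-upper₂ (inj₂ a) (inj₂ b) = lift (∧-lower₂ a b)

  ∨*-least : ∀ {x y z} → x ⊑* z → y ⊑* z → (x ∨* y) ⊑* z
  ∨*-least {inj₁ a} {inj₁ b} {inj₁ c} h₁ h₂ = lift (∨-least (unlift h₁) (unlift h₂))
  ∨*-least {inj₁ a} {inj₂ b} {inj₁ c} h₁ h₂ = h₁
  ∨*-least {inj₂ a} {inj₁ b} {inj₁ c} h₁ h₂ = h₂
  ∨*-least {inj₂ a} {inj₂ b} {inj₁ c} h₁ h₂ = refl
  ∨*-least {inj₁ a} {y}      {inj₂ c} ()
  ∨*-least {inj₂ a} {inj₁ b} {inj₂ c} h₁ ()
  ∨*-least {inj₂ a} {inj₂ b} {inj₂ c} h₁ h₂ = lift (∧-greatest (unlift h₁) (unlift h₂))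

  top* : ∀ x → x ⊑* inj₁ 𝟙
  top* (inj₁ a) = lift (top a)
  top* (inj₂ a) = refl

  ⊛-comm : ∀ x y → x ⊛ y ≡ y ⊛ x
  ⊛-comm (inj₁ a) (inj₁ b) = cong inj₁ (*-comm a b)
  ⊛-comm (inj₁ a) (inj₂ b) = refl
  ⊛-comm (inj₂ a) (inj₁ b) = refl
  ⊛-comm (inj₂ a) (inj₂ b) = refl

  -- Associativity of the product on mixed arguments is currying and
  -- exchange of implications in A.
  ⊛-assoc : ∀ x y z → (x ⊛ y) ⊛ z ≡ x ⊛ (y ⊛ z)
  ⊛-assoc (inj₁ a) (inj₁ b) (inj₁ c) = cong inj₁ (*-assoc a b c)
  ⊛-assoc (inj₁ a) (inj₁ b) (inj₂ c) = cong inj₂ (⇒-curry a b c)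
  ⊛-assoc (inj₁ a) (inj₂ b) (inj₁ c) = cong inj₂ (⇒-exchange c a b)
  ⊛-assoc (inj₂ a) (inj₁ b) (inj₁ c) = cong inj₂ (trans (⇒-exchange c b a) (sym (⇒-curry b c a)))
  ⊛-assoc (inj₁ a) (inj₂ b) (inj₂ c) = cong inj₂ (sym (top a))
  ⊛-assoc (inj₂ a) (inj₁ b) (inj₂ c) = refl
  ⊛-assoc (inj₂ a) (inj₂ b) (inj₁ c) = cong inj₂ (top c)
  ⊛-assoc (inj₂ a) (inj₂ b) (inj₂ c) = refl

  ⊛-identity : ∀ x → x ⊛ inj₁ 𝟙 ≡ x
  ⊛-identity (inj₁ a) = cong inj₁ (*-identity a)
  ⊛-identity (inj₂ a) = cong inj₂ (𝟙⇒-identity a)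

  -- Residuation on ¬A is residuation in A read backwards.
  flip-res : ∀ {a b c} → b * c ⊑ a → c * b ⊑ a
  flip-res {a} h = subst (_⊑ a) (*-comm _ _) h

  ⊛-res-intro : ∀ {x y z} → (x ⊛ y) ⊑* z → y ⊑* (x ⇒* z)
  ⊛-res-intro {inj₁ a} {inj₁ b} {inj₁ c} h = lift (res-intro (unlift h))
  ⊛-res-intro {inj₁ a} {inj₁ b} {inj₂ c} ()
  ⊛-res-intro {inj₁ a} {inj₂ b} {inj₁ c} h = refl
  ⊛-res-intro {inj₁ a} {inj₂ b} {inj₂ c} h = lift (res-elim (unlift h))
  ⊛-res-intro {inj₂ a} {inj₁ b} {inj₁ c} h = lift (top b)
  ⊛-res-intro {inj₂ a} {inj₁ b} {inj₂ c} h = lift (res-intro (flip-res (res-elim (unlift h))))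
  ⊛-res-intro {inj₂ a} {inj₂ b} {inj₁ c} h = refl
  ⊛-res-intro {inj₂ a} {inj₂ b} {inj₂ c} h = refl

  ⊛-res-elim : ∀ {x y z} → y ⊑* (x ⇒* z) → (x ⊛ y) ⊑* z
  ⊛-res-elim {inj₁ a} {inj₁ b} {inj₁ c} h = lift (res-elim (unlift h))
  ⊛-res-elim {inj₁ a} {inj₁ b} {inj₂ c} ()
  ⊛-res-elim {inj₁ a} {inj₂ b} {inj₁ c} h = refl
  ⊛-res-elim {inj₁ a} {inj₂ b} {inj₂ c} h = lift (res-intro (unlift h))
  ⊛-res-elim {inj₂ a} {inj₁ b} {inj₁ c} h = refl
  ⊛-res-elim {inj₂ a} {inj₁ b} {inj₂ c} h = lift (res-intro (flip-res (res-elim (unlift h))))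
  ⊛-res-elim {inj₂ a} {inj₂ b} {inj₁ c} h = refl
  ⊛-res-elim {inj₂ a} {inj₂ b} {inj₂ c} h = lift (top c)

  -- Every negative element squares to the bottom ¬1.
  ⊛-3-potent : ∀ x → (x ⊛ x) ⊑* (x ⊛ (x ⊛ x))
  ⊛-3-potent (inj₁ a) = lift (3-potent a)
  ⊛-3-potent (inj₂ a) = lift (⊑-refl 𝟙)

  ⊛-square-∨ : ∀ {x y z} → (x ⊛ x) ⊑* z → (y ⊛ y) ⊑* z → ((x ∨* y) ⊛ (x ∨* y)) ⊑* z
  ⊛-square-∨ {inj₁ a} {inj₁ b} {inj₁ c} h₁ h₂ = lift (square-∨ (unlift h₁) (unlift h₂))
  ⊛-square-∨ {inj₁ a} {inj₁ b} {inj₂ c} ()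
  ⊛-square-∨ {inj₁ a} {inj₂ b}          h₁ h₂ = h₁
  ⊛-square-∨ {inj₂ a} {inj₁ b}          h₁ h₂ = h₂
  ⊛-square-∨ {inj₂ a} {inj₂ b}          h₁ h₂ = h₁

  doubling-isPotent : IsPotentCIRL doubledCIRL
  doubling-isPotent = record
    { ⊑-refl = ⊑*-refl ; ⊑-trans = ⊑*-trans ; ⊑-antisym = ⊑*-antisym
    ; ∧-lower₁ = ∧*-lower₁ ; ∧-lower₂ = ∧*-lower₂ ; ∧-greatest = ∧*-greatest
    ; ∨-upper₁ = ∨*-upper₁ ; ∨-upper₂ = ∨*-upper₂ ; ∨-least = ∨*-least
    ; top = top* ; *-comm = ⊛-comm ; *-assoc = ⊛-assoc ; *-identity = ⊛-identity
    ; res-intro = ⊛-res-intro ; res-elim = ⊛-res-elim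
    ; 3-potent = ⊛-3-potent ; square-∨ = ⊛-square-∨
    }

module DoublingIsSAlgebra {ℓ : Level} {A : CIRLSig ℓ} (P : IsPotentCIRL A) where
  open CIRLSig A
  open IsPotentCIRL P
  open PotentCIRLTheory P
  open Doubling A using (D; _∧*_; _∨*_; _⇒*_; ¬*_)
  open DoublingIsPotent P
  open SSig (double A) using (imps; imps²)
  module A* = PotentCIRLTheory doubling-isPotent

  𝟘-least : ∀ y → inj₂ 𝟙 ⊑* y
  𝟘-least (inj₁ b) = refl
  𝟘-least (inj₂ b) = lift (top b)

  ¬*-⊑-⇒𝟘 : ∀ x → (¬* x) ⊑* (x ⇒* inj₂ 𝟙)
  ¬*-⊑-⇒𝟘 (inj₁ a) = lift (subst (_⊑ a) (sym (*-identity a)) (⊑-refl a))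
  ¬*-⊑-⇒𝟘 (inj₂ a) = lift (subst (a ⊑_) (sym (𝟙⇒-identity a)) (⊑-refl a))

  contraposition : ∀ x y → (¬* y) ⇒* (¬* x) ≡ x ⇒* y
  contraposition (inj₁ a) (inj₁ b) = refl
  contraposition (inj₁ a) (inj₂ b) = cong inj₂ (*-comm b a)
  contraposition (inj₂ a) (inj₁ b) = refl
  contraposition (inj₂ a) (inj₂ b) = refl

  contraposition-axiom : ∀ x y →
    ((x ⇒* y) ⇒* ((¬* y) ⇒* (¬* x))) ∧* (((¬* y) ⇒* (¬* x)) ⇒* (x ⇒* y)) ≡ inj₁ 𝟙
  contraposition-axiom x y = begin
    (u ⇒* ((¬* y) ⇒* (¬* x))) ∧* (((¬* y) ⇒* (¬* x)) ⇒* u)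
      ≡⟨ cong (λ t → (u ⇒* t) ∧* (t ⇒* u)) (contraposition x y) ⟩
    (u ⇒* u) ∧* (u ⇒* u)  ≡⟨ cong (λ t → t ∧* t) (⊑*-refl u) ⟩
    inj₁ (𝟙 ∧ 𝟙)          ≡⟨ cong inj₁ 𝟙∧𝟙 ⟩
    inj₁ 𝟙                ∎
    where
      open ≡-Reasoning
      u : D
      u = x ⇒* y

  ¬*-∧ : ∀ x y → ¬* (x ∧* y) ≡ (¬* x) ∨* (¬* y)
  ¬*-∧ (inj₁ a) (inj₁ b) = refl
  ¬*-∧ (inj₁ a) (inj₂ b) = refl
  ¬*-∧ (inj₂ a) (inj₁ b) = refl
  ¬*-∧ (inj₂ a) (inj₂ b) = refl

  ¬*-∨ : ∀ x y → ¬* (x ∨* y) ≡ (¬* x) ∧* (¬* y)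
  ¬*-∨ (inj₁ a) (inj₁ b) = refl
  ¬*-∨ (inj₁ a) (inj₂ b) = refl
  ¬*-∨ (inj₂ a) (inj₁ b) = refl
  ¬*-∨ (inj₂ a) (inj₂ b) = refl

  ¬*-involutive : ∀ x → ¬* (¬* x) ≡ x
  ¬*-involutive (inj₁ a) = refl
  ¬*-involutive (inj₂ a) = refl

  ¬*⇒-⊑ : ∀ x y → ¬* (x ⇒* y) ⊑* x ∧* (¬* y)
  ¬*⇒-⊑ (inj₁ a) (inj₁ b) = lift (weakening a b)
  ¬*⇒-⊑ (inj₁ a) (inj₂ b) = lift (∧-greatest (*-decreasingˡ a b) (*-decreasingʳ a b))
  ¬*⇒-⊑ (inj₂ a) (inj₁ b) = lift (top _)
  ¬*⇒-⊑ (inj₂ a) (inj₂ b) = lift (weakening b a)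

  negative-idempotent : ∀ {p c} → p ⊛ p ≡ p → p ⊑* inj₂ c → p ≡ inj₂ 𝟙
  negative-idempotent {inj₁ a} e ()
  negative-idempotent {inj₂ a} e h = sym e

  below-𝟘 : ∀ {p y} → p ≡ inj₂ 𝟙 → p ⊑* y
  below-𝟘 {y = y} refl = 𝟘-least y

  idempotent-¬⇒ : ∀ {p} x y → p ⊛ p ≡ p → p ⊑* x ∧* (¬* y) → p ⊑* ¬* (x ⇒* y)
  idempotent-¬⇒ (inj₁ a) (inj₂ b) e h = A*.idempotent-∧⇒* e h
  idempotent-¬⇒ (inj₁ a) (inj₁ b) e h = below-𝟘 (negative-idempotent e h)
  idempotent-¬⇒ (inj₂ a) (inj₁ b) e h = below-𝟘 (negative-idempotent e h)
  idempotent-¬⇒ (inj₂ a) (inj₂ b) e h = below-𝟘 (negative-idempotent e h)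

  imps≡⇒⋆ : ∀ Γ φ → imps Γ φ ≡ Γ A*.⇒⋆ φ
  imps≡⇒⋆ []      φ = refl
  imps≡⇒⋆ (x ∷ Γ) φ = cong (x ⇒*_) (imps≡⇒⋆ Γ φ)

  imps²≡⇒⋆ : ∀ Γ φ → imps² Γ φ ≡ A*.doubled Γ A*.⇒⋆ φ
  imps²≡⇒⋆ []      φ = refl
  imps²≡⇒⋆ (x ∷ Γ) φ = cong (λ t → x ⇒* (x ⇒* t)) (imps²≡⇒⋆ Γ φ)

  context-sound : ∀ Γ {φ} → imps Γ φ ≡ inj₁ 𝟙 → A*.∏ Γ ⊑* φ
  context-sound Γ {φ} h = A*.⇒⋆-sound Γ (trans (sym (imps≡⇒⋆ Γ φ)) h)

  context-complete : ∀ Γ {φ} → A*.∏ Γ ⊑* φ → imps Γ φ ≡ inj₁ 𝟙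
  context-complete Γ {φ} h = trans (imps≡⇒⋆ Γ φ) (A*.⇒⋆-complete Γ h)

  in-context : ∀ Γ {φ ψ} → (∀ {p} → p ⊑* φ → p ⊑* ψ) → imps Γ φ ≡ inj₁ 𝟙 → imps Γ ψ ≡ inj₁ 𝟙
  in-context Γ f h = context-complete Γ (f (context-sound Γ h))

  ¬⇒-right : ∀ Γ x y → imps² Γ (x ∧* (¬* y)) ≡ inj₁ 𝟙 → imps² Γ (¬* (x ⇒* y)) ≡ inj₁ 𝟙
  ¬⇒-right Γ x y h = trans (imps²≡⇒⋆ Γ _) (A*.⇒⋆-complete Δ
      (idempotent-¬⇒ x y (A*.∏-doubled-idempotent Γ) (A*.⇒⋆-sound Δ (trans (sym (imps²≡⇒⋆ Γ _)) h))))
    where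
      Δ : List D
      Δ = A*.doubled Γ

  on-left : ∀ {x x' y} → x ≡ x' → x' ⊑* y → x ⊑* y
  on-left refl h = h

  on-right : ∀ Γ {y y'} → y ≡ y' → imps Γ y' ≡ inj₁ 𝟙 → imps Γ y ≡ inj₁ 𝟙
  on-right Γ refl h = h

  doubling-isSAlgebra : IsSAlgebra (double A)
  doubling-isSAlgebra = record
    { A1      = ⊑*-refl
    ; A2      = 𝟘-least
    ; A3      = ¬*-⊑-⇒𝟘
    ; A4      = refl
    ; A5      = contraposition-axiom
    ; refl⇒   = ⊑*-refl
    ; rP      = λ Γ φ ψ γ → on-right Γ (A*.⇒-exchange ψ φ γ)
    ; rC      = A*.contraction
    ; rE      = λ Γ φ γ h₁ h₂ → in-context Γ (λ h → ⊑*-trans h h₂) h₁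
    ; r⇒l     = λ Γ φ ψ γ h₁ h₂ → in-context Γ (λ h → A*.⇒-left h h₂) h₁
    ; r⇒r     = λ φ γ h → on-right (φ ∷ []) h (top* φ)
    ; r∧l1    = λ φ ψ γ → ⊑*-trans (∧*-lower₁ φ ψ)
    ; r∧l2    = λ φ ψ γ → ⊑*-trans (∧*-lower₂ φ ψ)
    ; r∧r     = λ Γ φ ψ h₁ h₂ → context-complete Γ (∧*-greatest (context-sound Γ h₁) (context-sound Γ h₂))
    ; r∨l1    = λ φ ψ γ → ∨*-least
    ; r∨l2    = A*.square-∨-rule
    ; r∨r1    = λ Γ φ ψ → in-context Γ (λ h → ⊑*-trans h (∨*-upper₁ φ ψ))
    ; r∨r2    = λ Γ φ ψ → in-context Γ (λ h → ⊑*-trans h (∨*-upper₂ φ ψ))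
    ; r¬⇒l    = λ φ ψ γ → ⊑*-trans (¬*⇒-⊑ φ ψ)
    ; r¬⇒r    = ¬⇒-right
    ; r¬∧l    = λ φ ψ γ → on-left (¬*-∧ φ ψ)
    ; r¬∧r    = λ Γ φ ψ → on-right Γ (¬*-∧ φ ψ)
    ; r¬∨l    = λ φ ψ γ → on-left (¬*-∨ φ ψ)
    ; r¬∨r    = λ Γ φ ψ → on-right Γ (¬*-∨ φ ψ)
    ; r¬¬l    = λ φ γ → on-left (¬*-involutive φ)
    ; r¬¬r    = λ Γ φ → on-right Γ (¬*-involutive φ)
    ; antisym = λ x y → ⊑*-antisym
    }

-- An implicative lattice is a potent CIRL: its product is the meet, which is
-- idempotent, and its implication order is the lattice order.
module ImplicativeLatticeIsPotent {ℓ : Level} (L : ImplicativeLattice ℓ) where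
  open ImplicativeLattice L
  open CIRLSig sig
  open IsCIRL isCIRL

  lattice : Lattice ℓ ℓ
  lattice = record
    { Carrier   = Carrier
    ; _≈_       = _≡_
    ; _∨_       = _∨_
    ; _∧_       = _∧_
    ; isLattice = record
      { isEquivalence = isEquivalence
      ; ∨-comm        = ∨-comm
      ; ∨-assoc       = ∨-assoc
      ; ∨-cong        = cong₂ _∨_
      ; ∧-comm        = ∧-comm
      ; ∧-assoc       = ∧-assoc
      ; ∧-cong        = cong₂ _∧_
      ; absorptive    = ∨-absorbs-∧ , ∧-absorbs-∨
      }
    }

  open LatticeProperties lattice using (∧-idem; ∨-∧-isOrderTheoreticLattice)
  open OrderLattice.IsLattice ∨-∧-isOrderTheoreticLattice
    renaming (refl to ≼-refl; trans to ≼-trans; antisym to ≼-antisym)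

  infix 4 _≼_ _⊑_
  _≼_ : Carrier → Carrier → Set ℓ
  x ≼ y = x ≡ x ∧ y

  _⊑_ : Carrier → Carrier → Set ℓ
  x ⊑ y = (x ⇒ y) ≡ 𝟙

  𝟙≤⇒≡𝟙 : ∀ {t} → 𝟙 ≤ t → t ≡ 𝟙
  𝟙≤⇒≡𝟙 {t} h = trans (sym (top t)) (trans (∧-comm t 𝟙) h)

  -- Residuation with the unit: x ≤ y iff 𝟙 ≤ x ⇒ y.
  ≼⇒⊑ : ∀ {x y} → x ≼ y → x ⊑ y
  ≼⇒⊑ {x} {y} h = 𝟙≤⇒≡𝟙 (residuation₁ x 𝟙 y (subst (λ u → u ∧ y ≡ u) (sym (*-identity x)) (sym h)))

  ⊑⇒≼ : ∀ {x y} → x ⊑ y → x ≼ y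
  ⊑⇒≼ {x} {y} h = sym (subst (λ u → u ∧ y ≡ u) (*-identity x)
    (residuation₂ x 𝟙 y (subst (λ t → 𝟙 ∧ t ≡ 𝟙) (sym h) (∧-idem 𝟙))))

  *-idem : ∀ x → x * x ≡ x
  *-idem x = trans (*-is-∧ x x) (∧-idem x)

  implicativeLattice-isPotent : IsPotentCIRL sig
  implicativeLattice-isPotent = record
    { ⊑-refl     = λ x → ≼⇒⊑ ≼-refl
    ; ⊑-trans    = λ h₁ h₂ → ≼⇒⊑ (≼-trans (⊑⇒≼ h₁) (⊑⇒≼ h₂))
    ; ⊑-antisym  = λ h₁ h₂ → ≼-antisym (⊑⇒≼ h₁) (⊑⇒≼ h₂)
    ; ∧-lower₁   = λ x y → ≼⇒⊑ (x∧y≤x x y)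
    ; ∧-lower₂   = λ x y → ≼⇒⊑ (x∧y≤y x y)
    ; ∧-greatest = λ h₁ h₂ → ≼⇒⊑ (∧-greatest (⊑⇒≼ h₁) (⊑⇒≼ h₂))
    ; ∨-upper₁   = λ x y → ≼⇒⊑ (x≤x∨y x y)
    ; ∨-upper₂   = λ x y → ≼⇒⊑ (y≤x∨y x y)
    ; ∨-least    = λ h₁ h₂ → ≼⇒⊑ (∨-least (⊑⇒≼ h₁) (⊑⇒≼ h₂))
    ; top        = λ x → ≼⇒⊑ (sym (top x))
    ; *-comm     = *-comm
    ; *-assoc    = *-assoc
    ; *-identity = *-identity
    ; res-intro  = λ {x} {y} {z} h → ≼⇒⊑ (sym (residuation₁ x y z (sym (⊑⇒≼ h))))
    ; res-elim   = λ {x} {y} {z} h → ≼⇒⊑ (sym (residuation₂ x y z (sym (⊑⇒≼ h))))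
    ; 3-potent   = λ x → subst (x * x ⊑_) (sym (cong (x *_) (*-idem x))) (≼⇒⊑ ≼-refl)
    ; square-∨   = λ {x} {y} {z} h₁ h₂ → subst (_⊑ z) (sym (*-idem (x ∨ y)))
        (≼⇒⊑ (∨-least (⊑⇒≼ (subst (_⊑ z) (*-idem x) h₁)) (⊑⇒≼ (subst (_⊑ z) (*-idem y) h₂))))
    }

-- Everything is derived from the axioms and rules with empty or singleton
-- contexts; 3-potency is rule (C) and the square law for joins is rule (∨l2).
module SAlgebraReductIsPotent {ℓ : Level} (S : SAlgebra ℓ) where
  open SSig (SAlgebra.sig S)
  open IsSAlgebra (SAlgebra.isSAlgebra S)

  infix 4 _⊑_
  _⊑_ : Carrier → Carrier → Set ℓ
  x ⊑ y = (x ⇒ y) ≡ 𝟙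

  infixl 7 _·_
  _·_ : Carrier → Carrier → Carrier
  x · y = ¬ (x ⇒ ¬ y)

  detach : ∀ {x y} → x ≡ 𝟙 → x ⊑ y → y ≡ 𝟙
  detach {x} {y} = rE [] x y

  ⊑-trans : ∀ {x y z} → x ⊑ y → y ⊑ z → x ⊑ z
  ⊑-trans {x} {y} {z} = rE (x ∷ []) y z

  exchange : ∀ {x y z} → x ⊑ y ⇒ z → y ⊑ x ⇒ z
  exchange {x} {y} {z} = rP [] x y z

  contrapose : ∀ x y → (x ⇒ y) ⊑ (¬ y ⇒ ¬ x)
  contrapose x y = detach (A5 x y) (r∧l1 _ _ _ (A1 _))

  ¬¬-elim : ∀ x → ¬ ¬ x ⊑ x
  ¬¬-elim x = r¬¬l x x (A1 x)

  ¬¬-intro : ∀ x → x ⊑ ¬ ¬ x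
  ¬¬-intro x = r¬¬r (x ∷ []) x (A1 x)

  ¬¬⇒-strip : ∀ x y → (¬ ¬ x ⇒ ¬ ¬ y) ⊑ (x ⇒ y)
  ¬¬⇒-strip x y = exchange (r⇒l (x ∷ []) (¬ ¬ x) (¬ ¬ y) y (¬¬-intro x) (¬¬-elim y))

  -- Residuation of · against ⇒, via contraposition and double negation.
  ·-res-elim : ∀ {x y z} → y ⊑ x ⇒ z → x · y ⊑ z
  ·-res-elim {x} {y} {z} h = ⊑-trans ¬x⇒¬y⊑¬¬z (¬¬-elim z)
    where
      ¬z⊑x⇒¬y : ¬ z ⊑ x ⇒ ¬ y
      ¬z⊑x⇒¬y = exchange (⊑-trans (exchange h) (contrapose y z))
      ¬x⇒¬y⊑¬¬z : x · y ⊑ ¬ ¬ z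
      ¬x⇒¬y⊑¬¬z = detach ¬z⊑x⇒¬y (contrapose (¬ z) (x ⇒ ¬ y))

  ·-res-intro : ∀ {x y z} → x · y ⊑ z → y ⊑ x ⇒ z
  ·-res-intro {x} {y} {z} h = exchange (⊑-trans x⊑¬¬y⇒¬¬z (¬¬⇒-strip y z))
    where
      ¬z⊑x⇒¬y : ¬ z ⊑ x ⇒ ¬ y
      ¬z⊑x⇒¬y = ⊑-trans (detach h (contrapose (x · y) z)) (¬¬-elim (x ⇒ ¬ y))
      x⊑¬¬y⇒¬¬z : x ⊑ ¬ ¬ y ⇒ ¬ ¬ z
      x⊑¬¬y⇒¬¬z = ⊑-trans (exchange ¬z⊑x⇒¬y) (contrapose (¬ z) (¬ y))

  ·-comm-⊑ : ∀ x y → x · y ⊑ y · x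
  ·-comm-⊑ x y = ·-res-elim (exchange (·-res-intro (A1 (y · x))))

  ·-comm : ∀ x y → x · y ≡ y · x
  ·-comm x y = antisym _ _ (·-comm-⊑ x y) (·-comm-⊑ y x)

  ·-assoc-⊑ : ∀ x y z → (x · y) · z ⊑ x · (y · z)
  ·-assoc-⊑ x y z = subst (_⊑ w) (·-comm z (x · y))
      (·-res-elim (·-res-elim (rP (y ∷ []) z x w (exchange (·-res-intro (·-res-intro (A1 w)))))))
    where
      w : Carrier
      w = x · (y · z)

  ·-assoc : ∀ x y z → (x · y) · z ≡ x · (y · z)
  ·-assoc x y z = antisym _ _ (·-assoc-⊑ x y z) (subst₂ _⊑_ (sym reversed) reversed' (·-assoc-⊑ z y x))
    where
      reversed : x · (y · z) ≡ (z · y) · x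
      reversed = trans (·-comm x (y · z)) (cong (_· x) (·-comm y z))
      reversed' : z · (y · x) ≡ (x · y) · z
      reversed' = trans (cong (z ·_) (·-comm y x)) (·-comm z (x · y))

  𝟙⇒-⊑ : ∀ x → (𝟙 ⇒ x) ⊑ x
  𝟙⇒-⊑ x = r⇒l [] 𝟙 x x refl (A1 x)

  ·-identity : ∀ x → x · 𝟙 ≡ x
  ·-identity x = antisym _ _ (·-res-elim (r⇒r 𝟙 (x ⇒ x) (A1 x)))
    (subst (x ⊑_) (·-comm 𝟙 x) (⊑-trans (·-res-intro (A1 (𝟙 · x))) (𝟙⇒-⊑ (𝟙 · x))))

  reduct-isPotent : IsPotentCIRL (reduct S)
  reduct-isPotent = record
    { ⊑-refl     = A1
    ; ⊑-trans    = ⊑-trans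
    ; ⊑-antisym  = λ {x} {y} → antisym x y
    ; ∧-lower₁   = λ x y → r∧l1 x y x (A1 x)
    ; ∧-lower₂   = λ x y → r∧l2 x y y (A1 y)
    ; ∧-greatest = λ {x} {y} {z} → r∧r (z ∷ []) x y
    ; ∨-upper₁   = λ x y → r∨r1 (x ∷ []) x y (A1 x)
    ; ∨-upper₂   = λ x y → r∨r2 (y ∷ []) x y (A1 y)
    ; ∨-least    = λ {x} {y} {z} → r∨l1 x y z
    ; top        = λ x → r⇒r x 𝟙 refl
    ; *-comm     = ·-comm
    ; *-assoc    = ·-assoc
    ; *-identity = ·-identity
    ; res-intro  = ·-res-intro
    ; res-elim   = ·-res-elim
    ; 3-potent   = λ x → ·-res-elim (rC x (x · (x · x)) (·-res-intro (·-res-intro (A1 (x · (x · x))))))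
    ; square-∨   = λ {x} {y} {z} h₁ h₂ → ·-res-elim (r∨l2 x y z (·-res-intro h₁) (·-res-intro h₂))
    }

corollary5p4 : {ℓ : Level}
    → ((A : ImplicativeLattice ℓ) → IsSAlgebra (double (ImplicativeLattice.sig A)))
    × ((S : SAlgebra ℓ) → IsSAlgebra (double (reduct S)))
corollary5p4 =
    (λ L → DoublingIsSAlgebra.doubling-isSAlgebra (ImplicativeLatticeIsPotent.implicativeLattice-isPotent L))
  , (λ S → DoublingIsSAlgebra.doubling-isSAlgebra (SAlgebraReductIsPotent.reduct-isPotent S))
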